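{- Let $G$ be a finite $k$-colorable graph and $n\geq 1$ an integer. Then $C(I_n(G))\leq k(n-1)$.
   Context: A graph is $k$-colorable if its vertex set can be partitioned into $k$ independent sets. For a graph $G=(V,E)$, $I_n(G)=\{U\subseteq V:\ \alpha(G[U])<n\}$, where $\alpha$ is the independence number. For a finite simplicial complex $X$, a face $\sigma$ contained in a unique maximal face $\tau$ is a free face; if $|\sigma|\leq d$, removing all faces $\eta$ with $\sigma\subseteq\eta\subseteq\tau$ is an elementary $d$-collapse. $X$ is $d$-collapsible if a sequence of elementary $d$-collapses reduces it to the void complex (no faces at all). $C(X)$ is the minimum $d$ such that $X$ is $d$-collapsible. -}

module Defs where

open import Data.Nat using (ℕ; _≤_; _<_)
open import Data.Fin using (Fin)
open import Data.Fin.Subset using (Subset; _∈_; _⊆_; ∣_∣)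
open import Data.Product using (_×_; Σ)
open import Relation.Nullary using (¬_)
open import Relation.Binary using (Decidable)
open import Relation.Binary.PropositionalEquality using (_≡_; _≢_)

record Graph (m : ℕ) : Set₁ where
  field
    Adj    : Fin m → Fin m → Set
    adj?   : Decidable Adj
    sym    : ∀ {u v} → Adj u v → Adj v u
    irrefl : ∀ {u} → ¬ Adj u u
open Graph public

Independent : ∀ {m} → Graph m → Subset m → Set
Independent G S = ∀ {u v} → u ∈ S → v ∈ S → ¬ Adj G u v

Colorable : ∀ {m} → ℕ → Graph m → Set
Colorable {m} k G = Σ (Fin m → Fin k) λ c → ∀ {u v} → Adj G u v → c u ≢ c v

α[_∣_]<_ : ∀ {m} → Graph m → Subset m → ℕ → Set
α[ G ∣ U ]< n = ∀ S → S ⊆ U → Independent G S → ∣ S ∣ < n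

Complex : ℕ → Set₁
Complex m = Subset m → Set

I : ∀ {m} → ℕ → Graph m → Complex m
I n G U = α[ G ∣ U ]< n

MaximalFace : ∀ {m} → Complex m → Subset m → Set
MaximalFace X τ = X τ × (∀ η → X η → τ ⊆ η → η ≡ τ)

FreeFace : ∀ {m} → Complex m → Subset m → Subset m → Set
FreeFace X σ τ = X σ × σ ⊆ τ × MaximalFace X τ
               × (∀ τ′ → MaximalFace X τ′ → σ ⊆ τ′ → τ′ ≡ τ)

remove : ∀ {m} → Complex m → Subset m → Subset m → Complex m
remove X σ τ η = X η × ¬ (σ ⊆ η × η ⊆ τ)

Void : ∀ {m} → Complex m → Set
Void X = ∀ η → ¬ X η

data Collapsible {m : ℕ} (d : ℕ) : Complex m → Set₁ where
  done : ∀ {X} → Void X → Collapsible d X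
  step : ∀ {X} σ τ → FreeFace X σ τ → ∣ σ ∣ ≤ d
       → Collapsible d (remove X σ τ) → Collapsible d X

-- C(X) ≤ N, where C(X) = min { d : X is d-collapsible }
C[_]≤_ : ∀ {m} → Complex m → ℕ → Set₁
C[ X ]≤ N = Σ ℕ λ d → d ≤ N × Collapsible d X

{-# OPTIONS --safe #-}
module Submission where

-- If α(G[U]) < n, then each of the k colour classes of U is an independent
-- set, hence has at most n - 1 vertices, so every face of I_n(G) has at most
-- k(n - 1) vertices.  Any complex whose faces have at most d vertices is
-- d-collapsible: list all subsets so that every set comes after all of its
-- proper supersets and walk through the list, removing each set that is still
-- a face.  When a face τ is reached its proper supersets are no longer faces,
-- so τ is maximal, hence a free face of itself, and removing τ alone is an
-- elementary d-collapse.

open import Defs hiding (sym)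
open import Data.Bool.Properties using (T-≡)
open import Data.Fin using (Fin; toℕ)
open import Data.Fin.Properties using (toℕ<n; toℕ-injective; decFinSubset)
open import Data.Fin.Subset using (Subset; _∈_; _⊆_; ∣_∣; inside; outside; _∩_; ∁)
open import Data.Fin.Subset.Properties
  using (_∈?_; _⊆?_; ⊆-refl; ⊆-trans; drop-∷-⊆; x∈p∩q⁻; x∈∁p⇒x∉p; p∩q⊆p; Empty-unique; ∣⊥∣≡0)
open import Data.List using (List; []; _∷_; [_]; _++_; map)
open import Data.List.Membership.Propositional using () renaming (_∈_ to _∈ₗ_)
open import Data.List.Membership.Propositional.Properties using (∈-map⁺; ∈-++⁺ˡ; ∈-++⁺ʳ)
open import Data.List.Relation.Unary.All as All using (All; [])
import Data.List.Relation.Unary.All.Properties as All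
open import Data.List.Relation.Unary.AllPairs as AllPairs using (AllPairs; []; _∷_)
import Data.List.Relation.Unary.AllPairs.Properties as AllPairs
open import Data.List.Relation.Unary.Any as Any using (here; there)
open import Data.Nat using (ℕ; zero; suc; _+_; _*_; _∸_; _≤_; _<_; s≤s; s≤s⁻¹; _≡ᵇ_; _<?_)
open import Data.Nat.Properties
  using (≤-refl; ≤-reflexive; +-mono-≤; +-suc; n≮0; ≤∧≢⇒<; ≡ᵇ⇒≡; ≡⇒≡ᵇ; module ≤-Reasoning)
open import Data.Product using (_,_; proj₁; proj₂)
open import Data.Vec using ([]; _∷_; here; tabulate)
open import Data.Vec.Properties using (lookup∘tabulate; []=⇒lookup; lookup⇒[]=)
open import Function using (_∘_; case_of_; Equivalence)
open import Relation.Nullary.Decidable using (Dec; yes; no; map′; ¬?; _×-dec_; _→-dec_)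
open import Relation.Unary using (Decidable)
open import Relation.Binary.PropositionalEquality using (_≡_; refl; sym; trans; cong)

private
  variable
    m d : ℕ

∣p∣≡∣p∩q∣+∣p∩∁q∣ : ∀ (p q : Subset m) → ∣ p ∣ ≡ ∣ p ∩ q ∣ + ∣ p ∩ ∁ q ∣
∣p∣≡∣p∩q∣+∣p∩∁q∣ []            []            = refl
∣p∣≡∣p∩q∣+∣p∩∁q∣ (outside ∷ p) (_ ∷ q)       = ∣p∣≡∣p∩q∣+∣p∩∁q∣ p q
∣p∣≡∣p∩q∣+∣p∩∁q∣ (inside ∷ p)  (inside ∷ q)  = cong suc (∣p∣≡∣p∩q∣+∣p∩∁q∣ p q)
∣p∣≡∣p∩q∣+∣p∩∁q∣ (inside ∷ p)  (outside ∷ q) =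
  trans (cong suc (∣p∣≡∣p∩q∣+∣p∩∁q∣ p q)) (sym (+-suc _ _))

colourClass : (Fin m → ℕ) → ℕ → Subset m
colourClass c j = tabulate (λ x → c x ≡ᵇ j)

∈-colourClass⁺ : ∀ (c : Fin m → ℕ) {j x} → c x ≡ j → x ∈ colourClass c j
∈-colourClass⁺ c {j} {x} cx≡j =
  lookup⇒[]= x _ (trans (lookup∘tabulate _ x) (Equivalence.to T-≡ (≡⇒≡ᵇ (c x) j cx≡j)))

∈-colourClass⁻ : ∀ (c : Fin m → ℕ) {j x} → x ∈ colourClass c j → c x ≡ j
∈-colourClass⁻ c {j} {x} x∈ =
  ≡ᵇ⇒≡ (c x) j (Equivalence.from T-≡ (trans (sym (lookup∘tabulate _ x)) ([]=⇒lookup x∈)))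

Monochromatic : (Fin m → ℕ) → Subset m → Set
Monochromatic c q = ∀ {x y} → x ∈ q → y ∈ q → c x ≡ c y

colourClass-monochromatic : ∀ (c : Fin m → ℕ) j p → Monochromatic c (p ∩ colourClass c j)
colourClass-monochromatic c j p {x} {y} x∈ y∈ =
  trans (∈-colourClass⁻ c (proj₂ (x∈p∩q⁻ p _ x∈))) (sym (∈-colourClass⁻ c (proj₂ (x∈p∩q⁻ p _ y∈))))

pigeonhole : ∀ (c : Fin m → ℕ) k b (p : Subset m) →
             (∀ {x} → x ∈ p → c x < k) →
             (∀ q → q ⊆ p → Monochromatic c q → ∣ q ∣ ≤ b) →
             ∣ p ∣ ≤ k * b
pigeonhole {m} c zero b p c<0 _ =
  ≤-reflexive (trans (cong ∣_∣ (Empty-unique λ (x , x∈p) → n≮0 (c<0 x∈p))) (∣⊥∣≡0 m))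
pigeonhole c (suc k) b p c<1+k mono≤b = begin
  ∣ p ∣                         ≡⟨ ∣p∣≡∣p∩q∣+∣p∩∁q∣ p top ⟩
  ∣ p ∩ top ∣ + ∣ p ∩ ∁ top ∣  ≤⟨ +-mono-≤ top≤b rest≤k*b ⟩
  b + k * b                     ∎
  where
  open ≤-Reasoning
  top : Subset _
  top = colourClass c k
  top≤b : ∣ p ∩ top ∣ ≤ b
  top≤b = mono≤b (p ∩ top) (p∩q⊆p p top) (colourClass-monochromatic c k p)
  c<k : ∀ {x} → x ∈ p ∩ ∁ top → c x < k
  c<k x∈ with x∈p∩q⁻ p (∁ top) x∈
  ... | x∈p , x∈∁top = ≤∧≢⇒< (s≤s⁻¹ (c<1+k x∈p)) (x∈∁p⇒x∉p x∈∁top ∘ ∈-colourClass⁺ c)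
  rest≤k*b : ∣ p ∩ ∁ top ∣ ≤ k * b
  rest≤k*b = pigeonhole c k b (p ∩ ∁ top) c<k
    (λ q q⊆rest → mono≤b q (⊆-trans q⊆rest (p∩q⊆p p (∁ top))))

m<n⇒m≤n∸1 : ∀ {m n} → m < n → m ≤ n ∸ 1
m<n⇒m≤n∸1 (s≤s m≤n) = m≤n

monochromatic⇒independent : ∀ {k} {G : Graph m} ((col , proper) : Colorable k G) {S} →
                            Monochromatic (toℕ ∘ col) S → Independent G S
monochromatic⇒independent (col , proper) mono u∈S v∈S uv = proper uv (toℕ-injective (mono u∈S v∈S))

I-face-size : ∀ {k n} (G : Graph m) → Colorable k G → ∀ {U} → I n G U → ∣ U ∣ ≤ k * (n ∸ 1)
I-face-size {k = k} {n} G col@(c , _) {U} α<n =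
  pigeonhole (toℕ ∘ c) k (n ∸ 1) U (λ {x} _ → toℕ<n (c x))
    (λ S S⊆U mono → m<n⇒m≤n∸1 (α<n S S⊆U (monochromatic⇒independent {G = G} col mono)))

allSubset? : ∀ {P : Subset m → Set} → Decidable P → Dec (∀ p → P p)
allSubset? {zero}  P? = map′ (λ { P[] [] → P[] }) (λ ∀P → ∀P []) (P? [])
allSubset? {suc m} P? = map′
  (λ { (∀Pin , ∀Pout) (inside ∷ p) → ∀Pin p ; (∀Pin , ∀Pout) (outside ∷ p) → ∀Pout p })
  (λ ∀P → ∀P ∘ (inside ∷_) , ∀P ∘ (outside ∷_))
  (allSubset? (P? ∘ (inside ∷_)) ×-dec allSubset? (P? ∘ (outside ∷_)))

independent? : (G : Graph m) → Decidable (Independent G)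
independent? G S = map′ (λ ind {u} {v} u∈S v∈S → ind {u} u∈S {v} v∈S)
                         (λ ind {u} u∈S {v} v∈S → ind {u} {v} u∈S v∈S)
  (decFinSubset (_∈? S) λ {u} _ → decFinSubset (_∈? S) λ {v} _ → ¬? (adj? G u v))

I? : ∀ n (G : Graph m) → Decidable (I n G)
I? n G U = allSubset? λ S → S ⊆? U →-dec independent? G S →-dec ∣ S ∣ <? n

¬ProperSuperset : Subset m → Subset m → Set
¬ProperSuperset p q = p ⊆ q → q ≡ p

SupersetsFirst : List (Subset m) → Set
SupersetsFirst = AllPairs ¬ProperSuperset

subsets : ∀ m → List (Subset m)
subsets zero    = [ [] ]
subsets (suc m) = map (inside ∷_) (subsets m) ++ map (outside ∷_) (subsets m)

∈-subsets : ∀ (p : Subset m) → p ∈ₗ subsets m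
∈-subsets []            = here refl
∈-subsets (inside ∷ p)  = ∈-++⁺ˡ (∈-map⁺ (inside ∷_) (∈-subsets p))
∈-subsets (outside ∷ p) = ∈-++⁺ʳ _ (∈-map⁺ (outside ∷_) (∈-subsets p))

∷-¬ProperSuperset : ∀ s {p q : Subset m} → ¬ProperSuperset p q → ¬ProperSuperset (s ∷ p) (s ∷ q)
∷-¬ProperSuperset s ¬p⊂q s∷p⊆s∷q = cong (s ∷_) (¬p⊂q (drop-∷-⊆ s∷p⊆s∷q))

inside-¬ProperSuperset-outside : ∀ (p q : Subset m) → ¬ProperSuperset (inside ∷ p) (outside ∷ q)
inside-¬ProperSuperset-outside p q p⊆q = case p⊆q here of λ ()

subsets-supersetsFirst : ∀ m → SupersetsFirst (subsets m)
subsets-supersetsFirst zero    = [] ∷ []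
subsets-supersetsFirst (suc m) = AllPairs.++⁺ (prefixed inside) (prefixed outside)
  (All.map⁺ (All.universal (λ p → All.map⁺ (All.universal (inside-¬ProperSuperset-outside p) _)) _))
  where
  prefixed : ∀ s → SupersetsFirst (map (s ∷_) (subsets m))
  prefixed s = AllPairs.map⁺ (AllPairs.map (∷-¬ProperSuperset s) (subsets-supersetsFirst m))

maximal⇒free : ∀ {X : Complex m} {τ} → MaximalFace X τ → FreeFace X τ τ
maximal⇒free max@(Xτ , τ-max) = Xτ , ⊆-refl , max , λ τ′ (Xτ′ , _) τ⊆τ′ → τ-max τ′ Xτ′ τ⊆τ′

remove? : ∀ {X : Complex m} → Decidable X → ∀ σ τ → Decidable (remove X σ τ)
remove? X? σ τ η = X? η ×-dec ¬? (σ ⊆? η ×-dec η ⊆? τ)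

collapse-along : ∀ {X : Complex m} (L : List (Subset m)) → SupersetsFirst L → Decidable X →
                 (∀ {η} → X η → η ∈ₗ L) → (∀ {η} → X η → ∣ η ∣ ≤ d) → Collapsible d X
collapse-along [] _ _ X⊆[] _ = done λ η Xη → case X⊆[] Xη of λ ()
collapse-along {X = X} (U ∷ L) (U-first ∷ L-sorted) X? X⊆U∷L small with X? U
... | no ¬XU = collapse-along L L-sorted X?
  (λ Xη → Any.tail (λ { refl → ¬XU Xη }) (X⊆U∷L Xη)) small
... | yes XU = step U U (maximal⇒free (XU , U-maximal)) (small XU)
  (collapse-along L L-sorted (remove? X? U U)
    (λ (Xη , ¬U⊆η⊆U) → Any.tail (λ { refl → ¬U⊆η⊆U (⊆-refl , ⊆-refl) }) (X⊆U∷L Xη))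
    (small ∘ proj₁))
  where
  U-maximal : ∀ η → X η → U ⊆ η → η ≡ U
  U-maximal η Xη U⊆η with X⊆U∷L Xη
  ... | here η≡U  = η≡U
  ... | there η∈L = All.lookup U-first η∈L U⊆η

bounded⇒collapsible : ∀ {X : Complex m} → Decidable X → (∀ {η} → X η → ∣ η ∣ ≤ d) → Collapsible d X
bounded⇒collapsible {m} X? = collapse-along (subsets m) (subsets-supersetsFirst m) X? (λ {η} _ → ∈-subsets η)

proposition5p1 : ∀ {m} (G : Graph m) (k n : ℕ) → Colorable k G → 1 ≤ n
                 → C[ I n G ]≤ (k * (n ∸ 1))
proposition5p1 G k n col _ = k * (n ∸ 1) , ≤-refl , bounded⇒collapsible (I? n G) (I-face-size G col)
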